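{- Let $d\ge 4$. If every configuration in $S'_d$ is covered, then $Q^3_d$ is loose Hamilton connected.
   Context: $Q^3_d$ is the $3$-uniform hypergraph on $V_d=\{0,1,2\}^d$ whose edges are the triples of pairwise distinct sequences agreeing in $d-1$ coordinates. A loose path from $v_0$ to $v_{2\ell}$ consists of distinct vertices $v_0,\dots,v_{2\ell}$ and distinct edges $e_i=\{v_{2i-2},v_{2i-1},v_{2i}\}$, $i=1,\dots,\ell$. A hypergraph is loose Hamilton connected if for any two distinct vertices $a,b$ there is a loose path from $a$ to $b$ containing all vertices. A configuration is an ordered $4$-tuple $(a,b,x,y)$ of distinct vertices of $V_d$; it is covered if there is a loose path in $Q^3_d$ from $a$ to $b$ whose vertex set is exactly $V_d\setminus\{x,y\}$. For $v\in V_d$, $v_{[d-1]}$ denotes the first $d-1$ coordinates of $v$. A symmetry is a bijection of $V_d$ obtained by permuting the $d$ coordinates and applying, independently in each coordinate, a permutation of $\{0,1,2\}$; symmetries act on configurations vertexwise. $(a,b,x,y)$ is literally of form $t_1(d)$ if $a_d=x_d=0$, $b_d=1$, $y_d=2$ and $a_{[d-1]}\notin\{b_{[d-1]},x_{[d-1]},y_{[d-1]}\}$; of form $t_2(d)$ if $a_d=b_d=0$, $x_d=1$, $y_d=2$ and $a_{[d-1]}\notin\{b_{[d-1]},x_{[d-1]},y_{[d-1]}\}$; of form $t_3(d)$ if $a_d=x_d=0$ and $b_d=y_d=1$; of form $t_4(d)$ if $a_d=0$, $b_d=x_d=1$, $y_d=2$ and $b_{[d-1]}\notin\{a_{[d-1]},x_{[d-1]},y_{[d-1]}\}$;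 of form $t_5(d)$ if $a_d=b_d=0$, $x_d=1$, $y_d=2$ and $b_{[d-1]}\notin\{a_{[d-1]},x_{[d-1]},y_{[d-1]}\}$. It is literally of form $\phi_1$ if literally of form $t_1(d)$ and $b_i\in\{a_i,x_i,y_i\}$ for some $i\in[d-1]$; of form $\phi_2$ if literally of form $t_2(d)$ or $t_5(d)$ and there are $u\in\{a,b\}$, $v\in\{x,y\}$ and two distinct $i,i'\in[d-1]$ with $u_i=v_i$, $u_{i'}=v_{i'}$; of form $\phi_3$ if literally of form $t_3(d)$ and there is $i\in[d-1]$ with $a_i=y_i$ or $b_i=x_i$; of form $\phi_4$ if literally of form $t_4(d)$ and $a_i\in\{b_i,x_i,y_i\}$ for some $i\in[d-1]$. A configuration $c$ is of type $\phi_i$ if applying some symmetry to $c$, and possibly exchanging $x$ and $y$, yields a configuration literally of form $\phi_i$. Normalisation: write $(a,b,x,y)$ as a $d\times 4$ matrix with columns $a,b,x,y$. From a matrix, form $C$ by applying in each row the permutation of $\{0,1,2\}$ making that row lexicographically minimal, then sorting the rows lexicographically. Let $\tilde C$ be obtained likewise from the matrix with third and fourth columns exchanged. The normal form is the lexicographically smaller (row by row) of $C,\tilde C$; a configuration is normalised if it is the normal form of some configuration. $S'_d$ is the set of normalised configurations of type $\phi_1,\phi_2,\phi_3$ or $\phi_4$. -}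

module Defs where

open import Data.Nat using (ℕ; zero; suc; _≤_)
open import Data.Fin using (Fin; toℕ) renaming (zero to fz; suc to fs)
open import Data.Fin.Permutation using (Permutation′; _⟨$⟩ʳ_)
open import Data.Vec using (Vec; []; _∷_; lookup; tabulate; init; last; map)
import Data.Vec as V
open import Data.List using (List; []; _∷_; foldr)
import Data.List as L
open import Data.List.Relation.Unary.Unique.Propositional using (Unique)
open import Data.List.Membership.Propositional using (_∈_)
open import Data.Bool using (Bool; true; false; if_then_else_)
open import Data.Product using (Σ; ∃; ∃-syntax; _×_; _,_)
open import Data.Sum using (_⊎_)
open import Data.Empty using (⊥)
open import Relation.Binary.PropositionalEquality using (_≡_; _≢_)
open import Function.Bundles using (_⇔_)

Vertex : ℕ → Set
Vertex d = Vec (Fin 3) d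

Edge : ∀ {d} → Vertex d → Vertex d → Vertex d → Set
Edge {d} u v w =
  u ≢ v × v ≢ w × u ≢ w ×
  ∃[ i ] (∀ (j : Fin d) → j ≢ i → lookup u j ≡ lookup v j × lookup v j ≡ lookup w j)

data LPath {d : ℕ} : Vertex d → Vertex d → List (Vertex d) → Set where
  stop : (v : Vertex d) → LPath v v (v ∷ [])
  step : ∀ {u v w b rest} → Edge u v w → LPath w b (w ∷ rest) →
         LPath u b (u ∷ v ∷ w ∷ rest)

-- A loose path from a to b with vertex sequence vs: distinct vertices.
-- (Distinctness of the edges follows from distinctness of the vertices.)
LoosePath : ∀ {d} → Vertex d → Vertex d → List (Vertex d) → Set
LoosePath a b vs = LPath a b vs × Unique vs

LooseHamiltonConnected : ℕ → Set
LooseHamiltonConnected d =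
  ∀ (a b : Vertex d) → a ≢ b →
  ∃[ vs ] (LoosePath a b vs × (∀ v → v ∈ vs))

record Config (d : ℕ) : Set where
  constructor conf
  field
    a b x y : Vertex d
open Config public

Distinct : ∀ {d} → Config d → Set
Distinct c = a c ≢ b c × a c ≢ x c × a c ≢ y c × b c ≢ x c × b c ≢ y c × x c ≢ y c

swapXY : ∀ {d} → Config d → Config d
swapXY (conf a b x y) = conf a b y x

Covered : ∀ {d} → Config d → Set
Covered c =
  ∃[ vs ] (LoosePath (a c) (b c) vs ×
           (∀ v → (v ∈ vs) ⇔ (v ≢ x c × v ≢ y c)))

record Symmetry (d : ℕ) : Set where
  constructor sym
  field
    σ : Permutation′ d
    π : Fin d → Permutation′ 3

actV : ∀ {d} → Symmetry d → Vertex d → Vertex d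
actV (sym σ π) v = tabulate (λ i → π i ⟨$⟩ʳ lookup v (σ ⟨$⟩ʳ i))

act : ∀ {d} → Symmetry d → Config d → Config d
act g (conf a b x y) = conf (actV g a) (actV g b) (actV g x) (actV g y)

-- Literal forms (d = suc m; the last coordinate is coordinate d,
-- init v = v_{[d-1]}, lookup (init v) i = v_i for i ∈ [d-1]).

0F 1F 2F : Fin 3
0F = fz
1F = fs fz
2F = fs (fs fz)

module _ {m : ℕ} (c : Config (suc m)) where
  private
    A = a c ; B = b c ; X = x c ; Y = y c

  LitT1 LitT2 LitT3 LitT4 LitT5 : Set
  LitT1 = last A ≡ 0F × last X ≡ 0F × last B ≡ 1F × last Y ≡ 2F ×
          init A ≢ init B × init A ≢ init X × init A ≢ init Y
  LitT2 = last A ≡ 0F × last B ≡ 0F × last X ≡ 1F × last Y ≡ 2F ×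
          init A ≢ init B × init A ≢ init X × init A ≢ init Y
  LitT3 = last A ≡ 0F × last X ≡ 0F × last B ≡ 1F × last Y ≡ 1F
  LitT4 = last A ≡ 0F × last B ≡ 1F × last X ≡ 1F × last Y ≡ 2F ×
          init B ≢ init A × init B ≢ init X × init B ≢ init Y
  LitT5 = last A ≡ 0F × last B ≡ 0F × last X ≡ 1F × last Y ≡ 2F ×
          init B ≢ init A × init B ≢ init X × init B ≢ init Y

  _!_ : Vertex (suc m) → Fin m → Fin 3
  v ! i = lookup (init v) i

  LitPhi1 LitPhi2 LitPhi3 LitPhi4 : Set
  LitPhi1 = LitT1 × ∃[ i ] (B ! i ≡ A ! i ⊎ B ! i ≡ X ! i ⊎ B ! i ≡ Y ! i)
  LitPhi2 = (LitT2 ⊎ LitT5) ×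
            ∃[ u ] ∃[ v ] ∃[ i ] ∃[ i′ ]
              ((u ≡ A ⊎ u ≡ B) × (v ≡ X ⊎ v ≡ Y) × i ≢ i′ ×
               u ! i ≡ v ! i × u ! i′ ≡ v ! i′)
  LitPhi3 = LitT3 × ∃[ i ] (A ! i ≡ Y ! i ⊎ B ! i ≡ X ! i)
  LitPhi4 = LitT4 × ∃[ i ] (A ! i ≡ B ! i ⊎ A ! i ≡ X ! i ⊎ A ! i ≡ Y ! i)

OfType : ∀ {m} → (Config (suc m) → Set) → Config (suc m) → Set
OfType {m} P c = Σ (Symmetry (suc m)) λ g → (P (act g c) ⊎ P (swapXY (act g c)))

Row : Set
Row = Vec (Fin 3) 4

data Cmp : Set where
  lt eq gt : Cmp

cmpℕ : ℕ → ℕ → Cmp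
cmpℕ zero zero = eq
cmpℕ zero (suc _) = lt
cmpℕ (suc _) zero = gt
cmpℕ (suc m) (suc n) = cmpℕ m n

cmpVec : ∀ {n} → Vec (Fin 3) n → Vec (Fin 3) n → Cmp
cmpVec [] [] = eq
cmpVec (p ∷ ps) (q ∷ qs) with cmpℕ (toℕ p) (toℕ q)
... | lt = lt
... | gt = gt
... | eq = cmpVec ps qs

cmpRows : List Row → List Row → Cmp
cmpRows [] [] = eq
cmpRows [] (_ ∷ _) = lt
cmpRows (_ ∷ _) [] = gt
cmpRows (r ∷ rs) (s ∷ ss) with cmpVec r s
... | lt = lt
... | gt = gt
... | eq = cmpRows rs ss

leqVec : ∀ {n} → Vec (Fin 3) n → Vec (Fin 3) n → Bool
leqVec r s with cmpVec r s
... | gt = false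
... | _ = true

minVec : ∀ {n} → Vec (Fin 3) n → Vec (Fin 3) n → Vec (Fin 3) n
minVec r s = if leqVec r s then r else s

perms3 : List (Vec (Fin 3) 3)
perms3 = (0F ∷ 1F ∷ 2F ∷ []) ∷ (0F ∷ 2F ∷ 1F ∷ []) ∷ (1F ∷ 0F ∷ 2F ∷ []) ∷
         (1F ∷ 2F ∷ 0F ∷ []) ∷ (2F ∷ 0F ∷ 1F ∷ []) ∷ (2F ∷ 1F ∷ 0F ∷ []) ∷ []

canonRow : Row → Row
canonRow r = foldr (λ p acc → minVec (map (lookup p) r) acc) r perms3

insertRow : Row → List Row → List Row
insertRow r [] = r ∷ []
insertRow r (s ∷ ss) = if leqVec r s then r ∷ s ∷ ss else s ∷ insertRow r ss

sortRows : List Row → List Row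
sortRows = foldr insertRow []

matrix : ∀ {d} → Config d → List Row
matrix {d} c = V.toList (tabulate {n = d} λ i →
  lookup (a c) i ∷ lookup (b c) i ∷ lookup (x c) i ∷ lookup (y c) i ∷ [])

normalise : ∀ {d} → Config d → List Row
normalise c = sortRows (L.map canonRow (matrix c))

normalForm : ∀ {d} → Config d → List Row
normalForm c with cmpRows (normalise c) (normalise (swapXY c))
... | gt = normalise (swapXY c)
... | _ = normalise c

Normalised : ∀ {d} → Config d → Set
Normalised {d} c = Σ (Config d) λ c′ → (Distinct c′ × normalForm c′ ≡ matrix c)

InS′ : ∀ {d} → Config d → Set
InS′ {zero} c = ⊥
InS′ {suc m} c =
  Distinct c × Normalised c ×
  (OfType LitPhi1 c ⊎ OfType LitPhi2 c ⊎ OfType LitPhi3 c ⊎ OfType LitPhi4 c)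

-- Let a ≠ b, fix a coordinate k with a_k ≠ b_k and another coordinate κ,
-- and put z = a[κ := p], x = a[κ := q] with {p, q, a_κ} = {0, 1, 2}; then
-- {a, x, z} is an edge, so a loose Hamilton path from a to b is the edge
-- {a, x, z} followed by a loose path from z to b through every vertex but
-- a and x, i.e. a covering of the configuration (z, b, a, x).  Taking
-- p = b_κ when b_κ ≠ a_κ, that configuration is of type φ₂, and otherwise
-- of type φ₄.  Finally, every configuration is a symmetric image of its
-- normal form, and symmetries preserve types, distinctness and coverings,
-- so configurations of type φ₂ or φ₄ are covered as soon as S'_d is.
module Submission where

open import Defs
open import Data.Nat using (ℕ; zero; suc; _+_; _≤_; s≤s)
open import Data.Fin using (Fin; inject₁; fromℕ; punchIn) renaming (zero to fz; suc to fs)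
open import Data.Fin.Properties using (_≟_; fromℕ≢inject₁; punchInᵢ≢i; ¬∀⟶∃¬; all?)
open import Data.Fin.Permutation
  using (Permutation′; permutation; _⟨$⟩ʳ_; _⟨$⟩ˡ_; inverseˡ; inverseʳ; lift₀; _∘ₚ_; flip; transpose)
  renaming (id to idₚ)
open import Data.Vec using (Vec; []; _∷_; lookup; tabulate; init; last; map; _[_]≔_; toList)
open import Data.Vec.Properties
  using ( lookup∘tabulate; tabulate∘lookup; tabulate-cong; lookup-map; toList-map; map-id; map-cong
        ; lookup∘update; lookup∘update′; ≡-dec)
open import Data.Vec.Relation.Binary.Pointwise.Extensional using (ext; Pointwise-≡⇒≡)
open import Data.List using (List; []; _∷_; foldr)
import Data.List as List
open import Data.List.Membership.Propositional using (_∈_)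
open import Data.List.Membership.Propositional.Properties using (∈-map⁺; ∈-map⁻)
open import Data.List.Relation.Unary.Any using (here; there)
open import Data.List.Relation.Unary.All as All using (All; []; _∷_)
open import Data.List.Relation.Unary.AllPairs using (_∷_)
open import Data.List.Relation.Unary.Unique.Propositional.Properties using (map⁺)
open import Data.Bool using (true; false)
open import Data.Product using (Σ; ∃-syntax; _×_; _,_; proj₁; proj₂)
import Data.Product as Product
open import Data.Sum using (_⊎_; inj₁; inj₂)
import Data.Sum as Sum
open import Data.Empty using (⊥-elim)
open import Function using (_∘_; case_of_)
open import Function.Bundles using (mk⇔; Equivalence)
open import Relation.Nullary using (yes; no)
open import Relation.Nullary.Decidable using (True; toWitness)
open import Relation.Binary.PropositionalEquality
  using (_≡_; _≢_; refl; trans; cong; subst; module ≡-Reasoning)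
  renaming (sym to ≡-sym)

private
  variable
    A : Set
    d m n : ℕ

lookup-init : (v : Vec A (suc m)) (i : Fin m) → lookup (init v) i ≡ lookup v (inject₁ i)
lookup-init (_ ∷ _ ∷ _) fz = refl
lookup-init (_ ∷ w ∷ v) (fs i) = lookup-init (w ∷ v) i

last≡lookup-fromℕ : (v : Vec A (suc m)) → last v ≡ lookup v (fromℕ m)
last≡lookup-fromℕ (_ ∷ []) = refl
last≡lookup-fromℕ (_ ∷ w ∷ v) = last≡lookup-fromℕ (w ∷ v)

≢fromℕ⇒inject₁ : (j : Fin (suc m)) → j ≢ fromℕ m → ∃[ i ] inject₁ i ≡ j
≢fromℕ⇒inject₁ {zero} fz j≢m = ⊥-elim (j≢m refl)
≢fromℕ⇒inject₁ {suc m} fz _ = fz , refl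
≢fromℕ⇒inject₁ {suc m} (fs j) j≢m with ≢fromℕ⇒inject₁ j (j≢m ∘ cong fs)
... | i , refl = fs i , refl

reorder : Permutation′ n → Vec A n → Vec A n
reorder σ v = tabulate (λ j → lookup v (σ ⟨$⟩ʳ j))

reorder-∘ : (τ ρ : Permutation′ n) (v : Vec A n) → reorder τ (reorder ρ v) ≡ reorder (τ ∘ₚ ρ) v
reorder-∘ τ ρ v = tabulate-cong λ j → lookup∘tabulate _ (τ ⟨$⟩ʳ j)

Reorders : List A → Vec A n → Set
Reorders {n = n} l v = Σ (Permutation′ n) λ σ → l ≡ toList (reorder σ v)

insertRow-reorders : (r : Row) (w : Vec Row n) → Reorders (insertRow r (toList w)) (r ∷ w)
insertRow-reorders r [] = idₚ , refl
insertRow-reorders r (s ∷ w) with leqVec r s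
... | true = idₚ , cong toList (≡-sym (tabulate∘lookup (r ∷ s ∷ w)))
... | false with insertRow-reorders r w
...   | τ , ins≡ = lift₀ τ ∘ₚ transpose fz (fs fz) , cong (s ∷_) (trans ins≡ (cong toList (tabulate-cong (lookup-skip ∘ (τ ⟨$⟩ʳ_)))))
  where
  lookup-skip : ∀ k → lookup (r ∷ w) k ≡ lookup (r ∷ s ∷ w) (transpose fz (fs fz) ⟨$⟩ʳ fs k)
  lookup-skip fz = refl
  lookup-skip (fs k) = refl

sortRows-reorders : (v : Vec Row n) → Reorders (sortRows (toList v)) v
sortRows-reorders [] = idₚ , refl
sortRows-reorders (r ∷ v) with sortRows-reorders v
... | σ , sort≡ with insertRow-reorders r (reorder σ v)
...   | τ , ins≡ = τ ∘ₚ lift₀ σ , (begin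
  insertRow r (sortRows (toList v))      ≡⟨ cong (insertRow r) sort≡ ⟩
  insertRow r (toList (reorder σ v))     ≡⟨ ins≡ ⟩
  toList (reorder τ (r ∷ reorder σ v))   ≡⟨ cong toList (reorder-∘ τ (lift₀ σ) (r ∷ v)) ⟩
  toList (reorder (τ ∘ₚ lift₀ σ) (r ∷ v)) ∎)
  where open ≡-Reasoning

fromTables : (t u : Vec (Fin 3) 3) →
  {True (all? λ i → lookup t (lookup u i) ≟ i)} →
  {True (all? λ i → lookup u (lookup t i) ≟ i)} → Permutation′ 3
fromTables t u {tu} {ut} = permutation (lookup t) (lookup u) (toWitness tu) (toWitness ut)

π012 π021 π102 π120 π201 π210 : Permutation′ 3
π012 = fromTables (0F ∷ 1F ∷ 2F ∷ []) (0F ∷ 1F ∷ 2F ∷ [])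
π021 = fromTables (0F ∷ 2F ∷ 1F ∷ []) (0F ∷ 2F ∷ 1F ∷ [])
π102 = fromTables (1F ∷ 0F ∷ 2F ∷ []) (1F ∷ 0F ∷ 2F ∷ [])
π120 = fromTables (1F ∷ 2F ∷ 0F ∷ []) (2F ∷ 0F ∷ 1F ∷ [])
π201 = fromTables (2F ∷ 0F ∷ 1F ∷ []) (1F ∷ 2F ∷ 0F ∷ [])
π210 = fromTables (2F ∷ 1F ∷ 0F ∷ []) (2F ∷ 1F ∷ 0F ∷ [])

PermutationTable : Vec (Fin 3) 3 → Set
PermutationTable t = Σ (Permutation′ 3) λ P → ∀ i → P ⟨$⟩ʳ i ≡ lookup t i

perms3-are-permutations : All PermutationTable perms3
perms3-are-permutations =
  (π012 , λ _ → refl) ∷ (π021 , λ _ → refl) ∷ (π102 , λ _ → refl) ∷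
  (π120 , λ _ → refl) ∷ (π201 , λ _ → refl) ∷ (π210 , λ _ → refl) ∷ []

relabel-to-01 : ∀ p q → p ≢ q → Σ (Permutation′ 3) λ P → P ⟨$⟩ʳ p ≡ 0F × P ⟨$⟩ʳ q ≡ 1F
relabel-to-01 fz fz p≢q = ⊥-elim (p≢q refl)
relabel-to-01 fz (fs fz) _ = π012 , refl , refl
relabel-to-01 fz (fs (fs fz)) _ = π021 , refl , refl
relabel-to-01 (fs fz) fz _ = π102 , refl , refl
relabel-to-01 (fs fz) (fs fz) p≢q = ⊥-elim (p≢q refl)
relabel-to-01 (fs fz) (fs (fs fz)) _ = π201 , refl , refl
relabel-to-01 (fs (fs fz)) fz _ = π120 , refl , refl
relabel-to-01 (fs (fs fz)) (fs fz) _ = π210 , refl , refl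
relabel-to-01 (fs (fs fz)) (fs (fs fz)) p≢q = ⊥-elim (p≢q refl)

Relabels : Row → Row → Set
Relabels r s = Σ (Permutation′ 3) λ P → s ≡ map (P ⟨$⟩ʳ_) r

minVec-relabels : ∀ {r s s′} → Relabels r s → Relabels r s′ → Relabels r (minVec s s′)
minVec-relabels {s = s} {s′} rs rs′ with leqVec s s′
... | true = rs
... | false = rs′

-- Opaque: letting the type checker unfold the relabelling chosen here makes
-- checking normalise-act exhaust memory.
opaque
  canonRow-relabels : ∀ r → Relabels r (canonRow r)
  canonRow-relabels r = go perms3 perms3-are-permutations
    where
    go : ∀ ts → All PermutationTable ts →
         Relabels r (foldr (λ t acc → minVec (map (lookup t) r) acc) r ts)
    go [] [] = idₚ , ≡-sym (map-id r)
    go (t ∷ ts) ((P , P≗t) ∷ ps) = minVec-relabels (P , ≡-sym (map-cong P≗t r)) (go ts ps)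

lookup-actV : (g : Symmetry d) (v : Vertex d) (j : Fin d) →
  lookup (actV g v) j ≡ Symmetry.π g j ⟨$⟩ʳ lookup v (Symmetry.σ g ⟨$⟩ʳ j)
lookup-actV (sym σ π) v j = lookup∘tabulate _ j

inverse : Symmetry d → Symmetry d
inverse (sym σ π) = sym (flip σ) (λ i → flip (π (σ ⟨$⟩ˡ i)))

_∘ₛ_ : Symmetry d → Symmetry d → Symmetry d
sym σ π ∘ₛ sym σ′ π′ = sym (σ ∘ₚ σ′) (λ i → π′ (σ ⟨$⟩ʳ i) ∘ₚ π i)

actV-inverseˡ : (g : Symmetry d) (v : Vertex d) → actV (inverse g) (actV g v) ≡ v
actV-inverseˡ g@(sym σ π) v = Pointwise-≡⇒≡ (ext λ i → begin
  lookup (actV (inverse g) (actV g v)) i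
    ≡⟨ lookup-actV (inverse g) (actV g v) i ⟩
  flip (π (σ ⟨$⟩ˡ i)) ⟨$⟩ʳ lookup (actV g v) (σ ⟨$⟩ˡ i)
    ≡⟨ cong (flip (π (σ ⟨$⟩ˡ i)) ⟨$⟩ʳ_) (lookup-actV g v (σ ⟨$⟩ˡ i)) ⟩
  flip (π (σ ⟨$⟩ˡ i)) ⟨$⟩ʳ (π (σ ⟨$⟩ˡ i) ⟨$⟩ʳ lookup v (σ ⟨$⟩ʳ (σ ⟨$⟩ˡ i)))
    ≡⟨ inverseˡ (π (σ ⟨$⟩ˡ i)) ⟩
  lookup v (σ ⟨$⟩ʳ (σ ⟨$⟩ˡ i))
    ≡⟨ cong (lookup v) (inverseʳ σ) ⟩
  lookup v i ∎)
  where open ≡-Reasoning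

actV-inverseʳ : (g : Symmetry d) (v : Vertex d) → actV g (actV (inverse g) v) ≡ v
actV-inverseʳ g@(sym σ π) v = Pointwise-≡⇒≡ (ext λ i → begin
  lookup (actV g (actV (inverse g) v)) i
    ≡⟨ lookup-actV g (actV (inverse g) v) i ⟩
  π i ⟨$⟩ʳ lookup (actV (inverse g) v) (σ ⟨$⟩ʳ i)
    ≡⟨ cong (π i ⟨$⟩ʳ_) (lookup-actV (inverse g) v (σ ⟨$⟩ʳ i)) ⟩
  π i ⟨$⟩ʳ (flip (π (σ ⟨$⟩ˡ (σ ⟨$⟩ʳ i))) ⟨$⟩ʳ lookup v (σ ⟨$⟩ˡ (σ ⟨$⟩ʳ i)))
    ≡⟨ undo (inverseˡ σ) ⟩
  lookup v i ∎)
  where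
  open ≡-Reasoning
  undo : ∀ {i j} → j ≡ i → π i ⟨$⟩ʳ (flip (π j) ⟨$⟩ʳ lookup v j) ≡ lookup v i
  undo {i} refl = inverseʳ (π i)

actV-∘ : (g k : Symmetry d) (v : Vertex d) → actV (g ∘ₛ k) v ≡ actV g (actV k v)
actV-∘ (sym σ π) (sym σ′ π′) v = tabulate-cong λ i →
  ≡-sym (cong (π i ⟨$⟩ʳ_) (lookup∘tabulate _ (σ ⟨$⟩ʳ i)))

actV-injective : (g : Symmetry d) {u v : Vertex d} → actV g u ≡ actV g v → u ≡ v
actV-injective g {u} {v} gu≡gv = begin
  u                             ≡⟨ ≡-sym (actV-inverseˡ g u) ⟩
  actV (inverse g) (actV g u)   ≡⟨ cong (actV (inverse g)) gu≡gv ⟩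
  actV (inverse g) (actV g v)   ≡⟨ actV-inverseˡ g v ⟩
  v                             ∎
  where open ≡-Reasoning

actV-≢ : (g : Symmetry d) {u v : Vertex d} → u ≢ v → actV g u ≢ actV g v
actV-≢ g u≢v = u≢v ∘ actV-injective g

act-cong : ∀ {f h : Vertex d → Vertex d} (c : Config d) → (∀ v → f v ≡ h v) →
  conf (f (a c)) (f (b c)) (f (x c)) (f (y c)) ≡ conf (h (a c)) (h (b c)) (h (x c)) (h (y c))
act-cong (conf a b x y) f≗h rewrite f≗h a | f≗h b | f≗h x | f≗h y = refl

act-inverseˡ : (g : Symmetry d) (c : Config d) → act (inverse g) (act g c) ≡ c
act-inverseˡ g c = act-cong c (actV-inverseˡ g)

edge-act : (g : Symmetry d) {u v w : Vertex d} → Edge u v w → Edge (actV g u) (actV g v) (actV g w)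
edge-act g@(sym σ π) {u} {v} {w} (u≢v , v≢w , u≢w , i , agree) =
  actV-≢ g u≢v , actV-≢ g v≢w , actV-≢ g u≢w , σ ⟨$⟩ˡ i , λ j j≢ →
    let σj≢i : σ ⟨$⟩ʳ j ≢ i
        σj≢i σj≡i = j≢ (trans (≡-sym (inverseˡ σ)) (cong (σ ⟨$⟩ˡ_) σj≡i))
        uv , vw = agree (σ ⟨$⟩ʳ j) σj≢i
    in same u v uv , same v w vw
  where
  same : ∀ s t {j} → lookup s (σ ⟨$⟩ʳ j) ≡ lookup t (σ ⟨$⟩ʳ j) → lookup (actV g s) j ≡ lookup (actV g t) j
  same s t {j} st = trans (lookup-actV g s j) (trans (cong (π j ⟨$⟩ʳ_) st) (≡-sym (lookup-actV g t j)))

lpath-act : (g : Symmetry d) {u w : Vertex d} {vs : List (Vertex d)} →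
  LPath u w vs → LPath (actV g u) (actV g w) (List.map (actV g) vs)
lpath-act g (stop v) = stop (actV g v)
lpath-act g (step e p) = step (edge-act g e) (lpath-act g p)

covered-act : (g : Symmetry d) (c : Config d) → Covered c → Covered (act g c)
covered-act g c (vs , (path , unique) , avoids) =
  List.map (actV g) vs , (lpath-act g path , map⁺ (actV-injective g) unique) , λ v → mk⇔ (to v) (from v)
  where
  to : ∀ v → v ∈ List.map (actV g) vs → v ≢ actV g (x c) × v ≢ actV g (y c)
  to v v∈ with ∈-map⁻ (actV g) v∈
  ... | w , w∈ , refl with Equivalence.to (avoids w) w∈
  ...   | w≢x , w≢y = actV-≢ g w≢x , actV-≢ g w≢y
  from : ∀ v → v ≢ actV g (x c) × v ≢ actV g (y c) → v ∈ List.map (actV g) vs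
  from v (v≢gx , v≢gy) = subst (_∈ List.map (actV g) vs) (actV-inverseʳ g v)
    (∈-map⁺ (actV g) (Equivalence.from (avoids w) (w≢ v≢gx , w≢ v≢gy)))
    where
    w = actV (inverse g) v
    w≢ : ∀ {z} → v ≢ actV g z → w ≢ z
    w≢ v≢gz w≡z = v≢gz (trans (≡-sym (actV-inverseʳ g v)) (cong (actV g) w≡z))

covered-unact : (g : Symmetry d) (c : Config d) → Covered (act g c) → Covered c
covered-unact g c = subst Covered (act-inverseˡ g c) ∘ covered-act (inverse g) (act g c)

covered-swapXY : (c : Config d) → Covered (swapXY c) → Covered c
covered-swapXY c (vs , path , avoids) = vs , path , λ v →
  mk⇔ (Product.swap ∘ Equivalence.to (avoids v)) (Equivalence.from (avoids v) ∘ Product.swap)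

distinct-act : (g : Symmetry d) (c : Config d) → Distinct c → Distinct (act g c)
distinct-act g c (ab , ax , ay , bx , by , xy) =
  actV-≢ g ab , actV-≢ g ax , actV-≢ g ay , actV-≢ g bx , actV-≢ g by , actV-≢ g xy

distinct-unact : (g : Symmetry d) (c : Config d) → Distinct (act g c) → Distinct c
distinct-unact g c (ab , ax , ay , bx , by , xy) =
  ab ∘ cong (actV g) , ax ∘ cong (actV g) , ay ∘ cong (actV g) ,
  bx ∘ cong (actV g) , by ∘ cong (actV g) , xy ∘ cong (actV g)

distinct-swapXY : (c : Config d) → Distinct c → Distinct (swapXY c)
distinct-swapXY c (ab , ax , ay , bx , by , xy) = ab , ay , ax , by , bx , xy ∘ ≡-sym

OfTypeΦ : Config (suc m) → Set
OfTypeΦ c = OfType LitPhi1 c ⊎ OfType LitPhi2 c ⊎ OfType LitPhi3 c ⊎ OfType LitPhi4 c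

ofType-act : ∀ (P : Config (suc m) → Set) (h : Symmetry (suc m)) c → OfType P c → OfType P (act h c)
ofType-act P h c (g , lit) = g ∘ₛ inverse h , Sum.map (subst P (≡-sym g≡)) (subst P (cong swapXY (≡-sym g≡))) lit
  where
  g≡ : act (g ∘ₛ inverse h) (act h c) ≡ act g c
  g≡ = act-cong c λ v → trans (actV-∘ g (inverse h) (actV h v)) (cong (actV g) (actV-inverseˡ h v))

ofType-swapXY : ∀ (P : Config (suc m) → Set) c → OfType P c → OfType P (swapXY c)
ofType-swapXY P c (g , lit) = g , Sum.swap lit

ofTypeΦ-map : (c c′ : Config (suc m)) → (∀ P → OfType P c → OfType P c′) → OfTypeΦ c → OfTypeΦ c′
ofTypeΦ-map c c′ f = Sum.map (f LitPhi1) (Sum.map (f LitPhi2) (Sum.map (f LitPhi3) (f LitPhi4)))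

ofTypeΦ-act : (h : Symmetry (suc m)) (c : Config (suc m)) → OfTypeΦ c → OfTypeΦ (act h c)
ofTypeΦ-act h c = ofTypeΦ-map c (act h c) (λ P → ofType-act P h c)

ofTypeΦ-swapXY : (c : Config (suc m)) → OfTypeΦ c → OfTypeΦ (swapXY c)
ofTypeΦ-swapXY c = ofTypeΦ-map c (swapXY c) (λ P → ofType-swapXY P c)

rowOf : Config d → Fin d → Row
rowOf c i = lookup (a c) i ∷ lookup (b c) i ∷ lookup (x c) i ∷ lookup (y c) i ∷ []

rowOf-act : (g : Symmetry d) (c : Config d) (j : Fin d) →
  rowOf (act g c) j ≡ map (Symmetry.π g j ⟨$⟩ʳ_) (rowOf c (Symmetry.σ g ⟨$⟩ʳ j))
rowOf-act g c j
  rewrite lookup-actV g (a c) j | lookup-actV g (b c) j | lookup-actV g (x c) j | lookup-actV g (y c) j = refl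

reorder-relabelled-rows : (c : Config d) (σ : Permutation′ d) (P : Fin d → Permutation′ 3) →
  (∀ i → canonRow (rowOf c i) ≡ map (P i ⟨$⟩ʳ_) (rowOf c i)) →
  reorder σ (map canonRow (tabulate (rowOf c))) ≡ tabulate (rowOf (act (sym σ (P ∘ (σ ⟨$⟩ʳ_))) c))
reorder-relabelled-rows c σ P canon≡ = tabulate-cong λ j → begin
  lookup (map canonRow (tabulate (rowOf c))) (σ ⟨$⟩ʳ j)   ≡⟨ lookup-map (σ ⟨$⟩ʳ j) canonRow (tabulate (rowOf c)) ⟩
  canonRow (lookup (tabulate (rowOf c)) (σ ⟨$⟩ʳ j))        ≡⟨ cong canonRow (lookup∘tabulate (rowOf c) (σ ⟨$⟩ʳ j)) ⟩
  canonRow (rowOf c (σ ⟨$⟩ʳ j))                            ≡⟨ canon≡ (σ ⟨$⟩ʳ j) ⟩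
  map (P (σ ⟨$⟩ʳ j) ⟨$⟩ʳ_) (rowOf c (σ ⟨$⟩ʳ j))           ≡⟨ ≡-sym (rowOf-act (sym σ (P ∘ (σ ⟨$⟩ʳ_))) c j) ⟩
  rowOf (act (sym σ (P ∘ (σ ⟨$⟩ʳ_))) c) j                  ∎
  where open ≡-Reasoning

normalise-act : (c : Config d) → Σ (Symmetry d) λ h → normalise c ≡ matrix (act h c)
normalise-act {d} c with sortRows-reorders (map canonRow (tabulate (rowOf c)))
... | σ , sort≡ = h , (begin
  sortRows (List.map canonRow (toList rows))  ≡⟨ cong sortRows (≡-sym (toList-map canonRow rows)) ⟩
  sortRows (toList (map canonRow rows))       ≡⟨ sort≡ ⟩
  toList (reorder σ (map canonRow rows))      ≡⟨ cong toList (reorder-relabelled-rows c σ P (proj₂ ∘ relabelling)) ⟩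
  matrix (act h c)                            ∎)
  where
  open ≡-Reasoning
  rows = tabulate (rowOf c)
  relabelling : ∀ i → Relabels (rowOf c i) (canonRow (rowOf c i))
  relabelling i = canonRow-relabels (rowOf c i)
  P : Fin d → Permutation′ 3
  P = proj₁ ∘ relabelling
  h : Symmetry d
  h = sym σ (P ∘ (σ ⟨$⟩ʳ_))

normalForm-act : (c : Config d) → Σ (Symmetry d) λ h →
  normalForm c ≡ matrix (act h c) ⊎ normalForm c ≡ matrix (swapXY (act h c))
normalForm-act c with cmpRows (normalise c) (normalise (swapXY c))
... | lt = proj₁ (normalise-act c) , inj₁ (proj₂ (normalise-act c))
... | eq = proj₁ (normalise-act c) , inj₁ (proj₂ (normalise-act c))
... | gt = proj₁ (normalise-act (swapXY c)) , inj₂ (proj₂ (normalise-act (swapXY c)))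

covered-ofTypeΦ : (∀ (c : Config (suc m)) → InS′ c → Covered c) →
  ∀ c → Distinct c → OfTypeΦ c → Covered c
covered-ofTypeΦ covers c distinct φ = case normalForm-act c of λ where
  (h , inj₁ nf≡) → covered-unact h c (covers (act h c)
    (distinct-act h c distinct , (c , distinct , nf≡) , ofTypeΦ-act h c φ))
  (h , inj₂ nf≡) → covered-unact h c (covered-swapXY (act h c) (covers (swapXY (act h c))
    (distinct-swapXY (act h c) (distinct-act h c distinct) , (c , distinct , nf≡) ,
     ofTypeΦ-swapXY (act h c) (ofTypeΦ-act h c φ))))

module LastCoordinate (g : Symmetry (suc m)) {κ : Fin (suc m)} (σ[last]≡κ : Symmetry.σ g ⟨$⟩ʳ fromℕ m ≡ κ) where
  open Symmetry g

  last-actV : (v : Vertex (suc m)) → last (actV g v) ≡ π (fromℕ m) ⟨$⟩ʳ lookup v κ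
  last-actV v = begin
    last (actV g v)                            ≡⟨ last≡lookup-fromℕ (actV g v) ⟩
    lookup (actV g v) (fromℕ m)                ≡⟨ lookup-actV g v (fromℕ m) ⟩
    π (fromℕ m) ⟨$⟩ʳ lookup v (σ ⟨$⟩ʳ fromℕ m) ≡⟨ cong (λ j → π (fromℕ m) ⟨$⟩ʳ lookup v j) σ[last]≡κ ⟩
    π (fromℕ m) ⟨$⟩ʳ lookup v κ                ∎
    where open ≡-Reasoning

  lookup-init-actV : (v : Vertex (suc m)) (i : Fin m) → lookup (init (actV g v)) i ≡ π (inject₁ i) ⟨$⟩ʳ lookup v (σ ⟨$⟩ʳ inject₁ i)
  lookup-init-actV v i = trans (lookup-init (actV g v) i) (lookup-actV g v (inject₁ i))

  σ≢κ : ∀ j → j ≢ fromℕ m → σ ⟨$⟩ʳ j ≢ κ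
  σ≢κ j j≢last σj≡κ = j≢last (trans (≡-sym (inverseˡ σ)) (trans (cong (σ ⟨$⟩ˡ_) (trans σj≡κ (≡-sym σ[last]≡κ))) (inverseˡ σ)))

  init-actV-agree : (v w : Vertex (suc m)) → (∀ j → j ≢ κ → lookup v j ≡ lookup w j) →
    ∀ i → lookup (init (actV g v)) i ≡ lookup (init (actV g w)) i
  init-actV-agree v w v≈w i = begin
    lookup (init (actV g v)) i                       ≡⟨ lookup-init-actV v i ⟩
    π (inject₁ i) ⟨$⟩ʳ lookup v (σ ⟨$⟩ʳ inject₁ i)   ≡⟨ cong (π (inject₁ i) ⟨$⟩ʳ_) (v≈w _ (σ≢κ _ (fromℕ≢inject₁ ∘ ≡-sym))) ⟩
    π (inject₁ i) ⟨$⟩ʳ lookup w (σ ⟨$⟩ʳ inject₁ i)   ≡⟨ ≡-sym (lookup-init-actV w i) ⟩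
    lookup (init (actV g w)) i                       ∎
    where open ≡-Reasoning

  init-actV-≢ : (v w : Vertex (suc m)) {k : Fin (suc m)} → k ≢ κ → lookup v k ≢ lookup w k →
    init (actV g v) ≢ init (actV g w)
  init-actV-≢ v w {k} k≢κ vk≢wk gv≡gw = vk≢wk
    (subst (λ j → lookup v j ≡ lookup w j) (inverseʳ σ) (agree-at (≢fromℕ⇒inject₁ (σ ⟨$⟩ˡ k) σ⁻¹k≢last)))
    where
    σ⁻¹k≢last : σ ⟨$⟩ˡ k ≢ fromℕ m
    σ⁻¹k≢last k≡ = k≢κ (trans (≡-sym (inverseʳ σ)) (trans (cong (σ ⟨$⟩ʳ_) k≡) σ[last]≡κ))
    agree-at : ∀ {j} → ∃[ i ] inject₁ i ≡ j → lookup v (σ ⟨$⟩ʳ j) ≡ lookup w (σ ⟨$⟩ʳ j)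
    agree-at (i , refl) = trans (≡-sym (inverseˡ (π (inject₁ i))))
      (trans (cong (π (inject₁ i) ⟨$⟩ˡ_)
        (trans (≡-sym (lookup-init-actV v i)) (trans (cong (λ u → lookup u i) gv≡gw) (lookup-init-actV w i))))
      (inverseˡ (π (inject₁ i))))

transpose-second : (i j : Fin n) → transpose i j ⟨$⟩ʳ j ≡ i
transpose-second i j with j ≟ i
... | yes j≡i = j≡i
... | no _ with j ≟ j
...   | yes _ = refl
...   | no j≢j = ⊥-elim (j≢j refl)

HamiltonPath : Vertex d → Vertex d → Set
HamiltonPath {d} a b = ∃[ vs ] (LoosePath a b vs × (∀ (v : Vertex d) → v ∈ vs))

lpath-∷ : ∀ {a x z b : Vertex d} {vs} → Edge a x z → LPath z b vs → LPath a b (a ∷ x ∷ vs)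
lpath-∷ e (stop v) = step e (stop v)
lpath-∷ e (step e′ p) = step e (step e′ p)

hamiltonPath-via-edge : ∀ {a b x z : Vertex d} → Edge a x z → Covered (conf z b a x) → HamiltonPath a b
hamiltonPath-via-edge {a = a} {x = x} e@(a≢x , _) (vs , (path , unique) , avoids) =
  a ∷ x ∷ vs , (lpath-∷ e path , (a≢x ∷ All.tabulate (λ v∈ → proj₁ (avoids′ v∈) ∘ ≡-sym)) ∷
                                   All.tabulate (λ v∈ → proj₂ (avoids′ v∈) ∘ ≡-sym) ∷ unique) , visits
  where
  avoids′ : ∀ {v} → v ∈ vs → v ≢ a × v ≢ x
  avoids′ = Equivalence.to (avoids _)
  visits : ∀ v → v ∈ a ∷ x ∷ vs
  visits v with ≡-dec _≟_ v a | ≡-dec _≟_ v x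
  ... | yes v≡a | _ = here v≡a
  ... | no _ | yes v≡x = there (here v≡x)
  ... | no v≢a | no v≢x = there (there (Equivalence.from (avoids v) (v≢a , v≢x)))

module FirstEdge {n} (a b : Vertex (3 + n)) (κ k : Fin (3 + n)) (k≢κ : k ≢ κ)
                 (bk≢ak : lookup b k ≢ lookup a k) (p : Fin 3) (p≢aκ : p ≢ lookup a κ) where
  relabelling = relabel-to-01 p (lookup a κ) p≢aκ
  P = proj₁ relabelling
  Pp≡0 = proj₁ (proj₂ relabelling)
  Paκ≡1 = proj₂ (proj₂ relabelling)

  z x′ : Vertex (3 + n)
  z = a [ κ ]≔ p
  x′ = a [ κ ]≔ (P ⟨$⟩ˡ 2F)

  z≈a : ∀ j → j ≢ κ → lookup z j ≡ lookup a j
  z≈a j j≢κ = lookup∘update′ j≢κ a p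

  x≈a : ∀ j → j ≢ κ → lookup x′ j ≡ lookup a j
  x≈a j j≢κ = lookup∘update′ j≢κ a (P ⟨$⟩ˡ 2F)

  g : Symmetry (3 + n)
  g = sym (transpose κ (fromℕ (2 + n))) (λ _ → P)

  open LastCoordinate g (transpose-second κ (fromℕ (2 + n)))

  last-z : last (actV g z) ≡ 0F
  last-z = trans (last-actV z) (trans (cong (P ⟨$⟩ʳ_) (lookup∘update κ a p)) Pp≡0)

  last-a : last (actV g a) ≡ 1F
  last-a = trans (last-actV a) Paκ≡1

  last-x : last (actV g x′) ≡ 2F
  last-x = trans (last-actV x′) (trans (cong (P ⟨$⟩ʳ_) (lookup∘update κ a _)) (inverseʳ P))

  init-b≢ : ∀ v → (∀ j → j ≢ κ → lookup v j ≡ lookup a j) → init (actV g b) ≢ init (actV g v)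
  init-b≢ v v≈a = init-actV-≢ b v k≢κ (λ bk≡vk → bk≢ak (trans bk≡vk (v≈a k k≢κ)))

  z≈a-init : ∀ i → lookup (init (actV g z)) i ≡ lookup (init (actV g a)) i
  z≈a-init = init-actV-agree z a z≈a

  c : Config (3 + n)
  c = conf z b a x′

  distinct : Distinct c
  distinct = distinct-unact g c
    ( (init-b≢ z z≈a ∘ ≡-sym) ∘ cong init
    , ≢-last last-z last-a (λ ())
    , ≢-last last-z last-x (λ ())
    , init-b≢ a (λ _ _ → refl) ∘ cong init
    , init-b≢ x′ x≈a ∘ cong init
    , ≢-last last-a last-x (λ ()))
    where
    ≢-last : ∀ {u v : Vertex (3 + n)} {i j} → last u ≡ i → last v ≡ j → i ≢ j → u ≢ v
    ≢-last lu lv i≢j u≡v = i≢j (trans (≡-sym lu) (trans (cong last u≡v) lv))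

  edge : Edge a x′ z
  edge with distinct
  ... | _ , z≢a , z≢x , _ , _ , a≢x =
    a≢x , z≢x ∘ ≡-sym , z≢a ∘ ≡-sym , κ , λ j j≢κ → ≡-sym (x≈a j j≢κ) , trans (x≈a j j≢κ) (≡-sym (z≈a j j≢κ))

  -- φ₂ asks for two coordinates of [d-1] on which z and a agree; z and a
  -- differ only at κ, which g moves to the last place, so any two will do;
  -- this is where d ≥ 3 is used.
  ofTypeΦ : lookup b κ ≡ p ⊎ lookup b κ ≡ lookup a κ → OfTypeΦ c
  ofTypeΦ (inj₁ bκ≡p) = inj₂ (inj₁ (g , inj₁ (inj₂ t₅ , actV g z , actV g a , fz , fs fz ,
                                              inj₁ refl , inj₁ refl , (λ ()) , z≈a-init fz , z≈a-init (fs fz))))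
    where
    t₅ = last-z , trans (last-actV b) (trans (cong (P ⟨$⟩ʳ_) bκ≡p) Pp≡0) , last-a , last-x ,
         init-b≢ z z≈a , init-b≢ a (λ _ _ → refl) , init-b≢ x′ x≈a
  ofTypeΦ (inj₂ bκ≡aκ) = inj₂ (inj₂ (inj₂ (g , inj₁ (t₄ , fz , inj₂ (inj₁ (z≈a-init fz))))))
    where
    t₄ = last-z , trans (last-actV b) (trans (cong (P ⟨$⟩ʳ_) bκ≡aκ) Paκ≡1) , last-a , last-x ,
         init-b≢ z z≈a , init-b≢ a (λ _ _ → refl) , init-b≢ x′ x≈a

  hamiltonPath : (∀ (c : Config (3 + n)) → InS′ c → Covered c) →
    lookup b κ ≡ p ⊎ lookup b κ ≡ lookup a κ → HamiltonPath a b
  hamiltonPath covers bκ = hamiltonPath-via-edge {b = b} edge (covered-ofTypeΦ covers c distinct (ofTypeΦ bκ))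

looseHamiltonConnected : (∀ (c : Config (3 + n)) → InS′ c → Covered c) → LooseHamiltonConnected (3 + n)
looseHamiltonConnected covers a b a≢b = case lookup b κ ≟ lookup a κ of λ where
    (no bκ≢aκ) → FirstEdge.hamiltonPath a b κ k k≢κ bk≢ak (lookup b κ) bκ≢aκ covers (inj₁ refl)
    (yes bκ≡aκ) → FirstEdge.hamiltonPath a b κ k k≢κ bk≢ak (punchIn (lookup a κ) fz) (punchInᵢ≢i (lookup a κ) fz)
                    covers (inj₂ bκ≡aκ)
  where
  differing : ∃[ k ] lookup b k ≢ lookup a k
  differing = ¬∀⟶∃¬ _ _ (λ i → lookup b i ≟ lookup a i) (λ b≈a → a≢b (≡-sym (Pointwise-≡⇒≡ (ext b≈a))))
  k = proj₁ differing
  bk≢ak = proj₂ differing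
  κ = punchIn k fz
  k≢κ : k ≢ κ
  k≢κ = punchInᵢ≢i k fz ∘ ≡-sym

proposition1p8 : (d : ℕ) → 4 ≤ d →
    (∀ (c : Config d) → InS′ c → Covered c) →
    LooseHamiltonConnected d
proposition1p8 (suc (suc (suc n))) (s≤s (s≤s (s≤s _))) = looseHamiltonConnected
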